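{- Let $\bar{\mathcal{C}}=(\mathcal{C}_0,\ldots,\mathcal{C}_\ell)$ be a covering family of $G$, and let $P_1\neq P_2$ be parts of its overlay with $\mathrm{age}(P_1)=\mathrm{age}(P_2)=r$. For $0\le j\le\ell$ let $\mathcal{P}_j$ be the partition of $V$ obtained by superimposing all sets of $\mathcal{C}_0,\ldots,\mathcal{C}_j$ (i.e., $u,v$ are in the same part of $\mathcal{P}_j$ iff for every $i\le j$ and every $C\in\mathcal{C}_i$, either both or neither of $u,v$ belong to $C$), and let $\mathcal{P}_j(P)$ denote the part of $\mathcal{P}_j$ containing $P$. Then $\mathcal{P}_r(P_1)\neq\mathcal{P}_r(P_2)$.
   Context: Fix a positive integer $m$ such that $\ell:=\frac13\log_2 m$ is an integer, and let $G=(V,E)$ be a connected undirected graph (parallel edges allowed) with at most $m$ edges. For $S\subseteq V$, $E(S)$ is the set of edges with both endpoints in $S$. A subdivision is a collection of pairwise disjoint subsets of $V$. A covering family is a tuple $(\mathcal{C}_0,\ldots,\mathcal{C}_\ell)$ of subdivisions with $\mathcal{C}_0=\{V\}$ and $|E(C)|\le m/2^i$ for every $C\in\mathcal{C}_i$. Its overlay is the partition $\mathcal{P}_\ell$ (as defined in the claim with $j=\ell$); each part of the overlay is either contained in or disjoint from each set of the family. A part $P$ of the overlay has age $\mathrm{age}(P)=r$ if $P$ is contained in some set of $\mathcal{C}_r$ and in no set of $\mathcal{C}_{r'}$ with $r'>r$. -}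

module Defs where

open import Data.Nat using (ℕ; zero; suc; _+_; _*_; _^_; _≤_; _<_)
open import Data.Bool using (Bool; true; false; _∧_; if_then_else_)
open import Data.Vec using () renaming (lookup to vlookup)
open import Data.Fin using (Fin; toℕ)
open import Data.Fin.Subset using (Subset; _∈_; _∉_; _⊆_; ⊤)
open import Data.List using (List; []; _∷_; length; lookup)
open import Data.List.Membership.Propositional using () renaming (_∈_ to _∈ₗ_)
open import Data.Product using (Σ; _×_; _,_; ∃; ∃-syntax)
open import Data.Sum using (_⊎_)
open import Relation.Nullary using (¬_)
open import Relation.Binary.PropositionalEquality using (_≡_; _≢_)
open import Relation.Binary.Construct.Closure.ReflexiveTransitive using (Star)
open import Function.Bundles using (_⇔_)

-- A multigraph on vertex set V = Fin n: a list of edges (parallel edges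
-- allowed); an undirected edge {u,v} is stored as the pair (u , v).
Graph : ℕ → Set
Graph n = List (Fin n × Fin n)

Adjacent : ∀ {n} → Graph n → Fin n → Fin n → Set
Adjacent E u v = ((u , v) ∈ₗ E) ⊎ ((v , u) ∈ₗ E)

Connected : ∀ {n} → Graph n → Set
Connected E = ∀ u v → Star (Adjacent E) u v

countE : ∀ {n} → Graph n → Subset n → ℕ
countE [] S = 0
countE ((u , v) ∷ E) S =
  (if vlookup S u ∧ vlookup S v then 1 else 0) + countE E S

Disjoint : ∀ {n} → Subset n → Subset n → Set
Disjoint A B = ∀ x → ¬ (x ∈ A × x ∈ B)

Subdivision : ℕ → Set
Subdivision n = List (Subset n)

PairwiseDisjoint : ∀ {n} → Subdivision n → Set
PairwiseDisjoint 𝒞 = ∀ a b → a ≢ b → Disjoint (lookup 𝒞 a) (lookup 𝒞 b)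

Family : ℕ → ℕ → Set
Family n ℓ = Fin (suc ℓ) → Subdivision n

IsCoveringFamily : ∀ {n ℓ} → Graph n → ℕ → Family n ℓ → Set
IsCoveringFamily {n} {ℓ} E m 𝒞 =
  (∀ i → PairwiseDisjoint (𝒞 i)) ×
  (𝒞 Data.Fin.zero ≡ ⊤ ∷ []) ×
  (∀ i C → C ∈ₗ 𝒞 i → countE E C * 2 ^ toℕ i ≤ m)

SameP : ∀ {n ℓ} → Family n ℓ → Fin (suc ℓ) → Fin n → Fin n → Set
SameP 𝒞 j u v = ∀ i → toℕ i ≤ toℕ j → ∀ C → C ∈ₗ 𝒞 i → (u ∈ C ⇔ v ∈ C)

IsPartOf : ∀ {n ℓ} → Family n ℓ → Fin (suc ℓ) → Subset n → Set
IsPartOf 𝒞 j P = ∃[ u ] (∀ v → v ∈ P ⇔ SameP 𝒞 j u v)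

IsOverlayPart : ∀ {n ℓ} → Family n ℓ → Subset n → Set
IsOverlayPart {ℓ = ℓ} 𝒞 P = IsPartOf 𝒞 (Data.Fin.fromℕ ℓ) P

HasAge : ∀ {n ℓ} → Family n ℓ → Subset n → Fin (suc ℓ) → Set
HasAge 𝒞 P r =
  (∃[ C ] (C ∈ₗ 𝒞 r × P ⊆ C)) ×
  (∀ r' → toℕ r < toℕ r' → ∀ C → C ∈ₗ 𝒞 r' → ¬ (P ⊆ C))

-- If 𝒫_r(P₁) = 𝒫_r(P₂), then representatives u₁ ∈ P₁ and
-- u₂ ∈ P₂ agree on every set of 𝒞_0, …, 𝒞_r.  A set of a later level
-- containing uₖ would contain the whole overlay part Pₖ, which the age
-- forbids, so u₁ and u₂ lie in no set of a later level; hence they agree on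
-- all sets of the family, i.e. P₁ = P₂.

module Submission where

open import Defs
open import Data.Nat using (ℕ; suc; _*_; _^_; _≤_)
open import Data.Fin using (Fin)
open import Data.Fin.Subset using (Subset; _⊆_)
open import Data.List using (length)
open import Relation.Binary.PropositionalEquality using (_≢_)

open import Data.Nat using (_<_; _≤?_)
open import Data.Nat.Properties using (≰⇒>)
open import Data.Fin using (toℕ; fromℕ)
open import Data.Fin.Properties using (≤fromℕ)
open import Data.Fin.Subset using (_∈_; _∉_)
open import Data.Fin.Subset.Properties using (⊆-antisym)
open import Data.List.Membership.Propositional using () renaming (_∈_ to _∈ₗ_)
open import Data.Product using (_,_; proj₂)
open import Data.Empty using (⊥-elim)
open import Relation.Nullary using (yes; no)
open import Relation.Binary.PropositionalEquality using (_≡_; refl)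
open import Relation.Binary.Structures using (IsEquivalence)
open import Function.Bundles using (_⇔_; mk⇔; Equivalence)
open import Function.Properties.Equivalence using (⇔-isEquivalence)
open import Level using (0ℓ)

open Equivalence using (to; from)
private module ⇔ = IsEquivalence (⇔-isEquivalence {ℓ = 0ℓ})

module _ {n ℓ : ℕ} (𝒞 : Family n ℓ) where

  IsClassOf : Fin (suc ℓ) → Fin n → Subset n → Set
  IsClassOf j u P = ∀ v → v ∈ P ⇔ SameP 𝒞 j u v

  module _ {j : Fin (suc ℓ)} where

    SameP-refl : ∀ {u} → SameP 𝒞 j u u
    SameP-refl _ _ _ _ = ⇔.refl

    SameP-sym : ∀ {u v} → SameP 𝒞 j u v → SameP 𝒞 j v u
    SameP-sym u~v i i≤j C C∈ = ⇔.sym (u~v i i≤j C C∈)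

    SameP-trans : ∀ {u v w} → SameP 𝒞 j u v → SameP 𝒞 j v w → SameP 𝒞 j u w
    SameP-trans u~v v~w i i≤j C C∈ = ⇔.trans (u~v i i≤j C C∈) (v~w i i≤j C C∈)

    rep∈class : ∀ {u P} → IsClassOf j u P → u ∈ P
    rep∈class {u} P-cls = from (P-cls u) SameP-refl

    class-⊆ : ∀ {u v P Q} → IsClassOf j u P → IsClassOf j v Q →
              SameP 𝒞 j u v → P ⊆ Q
    class-⊆ P-cls Q-cls u~v {x} x∈P =
      from (Q-cls x) (SameP-trans (SameP-sym u~v) (to (P-cls x) x∈P))

    class-unique : ∀ {u v P Q} → IsClassOf j u P → IsClassOf j v Q →
                   SameP 𝒞 j u v → P ≡ Q
    class-unique P-cls Q-cls u~v =
      ⊆-antisym (class-⊆ P-cls Q-cls u~v) (class-⊆ Q-cls P-cls (SameP-sym u~v))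

    class-⊆-set : ∀ {u P i C} → IsClassOf j u P → toℕ i ≤ toℕ j →
                  C ∈ₗ 𝒞 i → u ∈ C → P ⊆ C
    class-⊆-set {i = i} {C} P-cls i≤j C∈ u∈C {x} x∈P =
      to (to (P-cls x) x∈P i i≤j C C∈) u∈C

  overlay-rep-avoids-younger : ∀ {u P r i C} → IsClassOf (fromℕ ℓ) u P →
                               HasAge 𝒞 P r → toℕ r < toℕ i → C ∈ₗ 𝒞 i → u ∉ C
  overlay-rep-avoids-younger {i = i} P-cls age r<i C∈ u∈C =
    proj₂ age i r<i _ C∈ (class-⊆-set P-cls (≤fromℕ i) C∈ u∈C)

  SameP-beyond : ∀ {r j u v} → SameP 𝒞 r u v →
                 (∀ {i C} → toℕ r < toℕ i → C ∈ₗ 𝒞 i → u ∉ C) →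
                 (∀ {i C} → toℕ r < toℕ i → C ∈ₗ 𝒞 i → v ∉ C) →
                 SameP 𝒞 j u v
  SameP-beyond {r} u~v u-avoids v-avoids i _ C C∈ with toℕ i ≤? toℕ r
  ... | yes i≤r = u~v i i≤r C C∈
  ... | no  i≰r = mk⇔ (λ u∈C → ⊥-elim (u-avoids (≰⇒> i≰r) C∈ u∈C))
                      (λ v∈C → ⊥-elim (v-avoids (≰⇒> i≰r) C∈ v∈C))

lemma11 : (ℓ n : ℕ) (E : Graph n) → Connected E → length E ≤ 2 ^ (3 * ℓ) →
          (𝒞 : Family n ℓ) → IsCoveringFamily E (2 ^ (3 * ℓ)) 𝒞 →
          (P₁ P₂ : Subset n) → IsOverlayPart 𝒞 P₁ → IsOverlayPart 𝒞 P₂ → P₁ ≢ P₂ →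
          (r : Fin (suc ℓ)) → HasAge 𝒞 P₁ r → HasAge 𝒞 P₂ r →
          (Q₁ Q₂ : Subset n) → IsPartOf 𝒞 r Q₁ → IsPartOf 𝒞 r Q₂ →
          P₁ ⊆ Q₁ → P₂ ⊆ Q₂ → Q₁ ≢ Q₂
lemma11 ℓ n E _ _ 𝒞 _ P₁ P₂ (u₁ , P₁-cls) (u₂ , P₂-cls) P₁≢P₂ r age₁ age₂
        Q₁ Q₂ (w , Q-cls) _ P₁⊆Q P₂⊆Q refl =
  P₁≢P₂ (class-unique 𝒞 P₁-cls P₂-cls u₁~u₂)
  where
  u₁~ᵣu₂ : SameP 𝒞 r u₁ u₂
  u₁~ᵣu₂ = SameP-trans 𝒞
    (SameP-sym 𝒞 (to (Q-cls u₁) (P₁⊆Q (rep∈class 𝒞 P₁-cls))))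
    (to (Q-cls u₂) (P₂⊆Q (rep∈class 𝒞 P₂-cls)))

  u₁~u₂ : SameP 𝒞 (fromℕ ℓ) u₁ u₂
  u₁~u₂ = SameP-beyond 𝒞 u₁~ᵣu₂
    (overlay-rep-avoids-younger 𝒞 P₁-cls age₁)
    (overlay-rep-avoids-younger 𝒞 P₂-cls age₂)
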